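{- Let $H=(V,E)$ be a finite simple graph with no vertices of degree $0$ or $1$. If there exists a subset $X\subseteq V$ with $|N(X)|<|X|$, then $H$ contains an induced subgraph isomorphic to the claw $K_{1,3}$.
   Context: $N(v)=\{w\in V: vw\in E\}$ is the open neighborhood of $v$, and $N(X)=\bigcup_{v\in X}N(v)$. -}

module Defs where

open import Data.Nat using (ℕ; _<_; _≥_)
open import Data.Bool using (Bool; true; false; _∨_; _∧_)
open import Data.Fin using (Fin)
open import Data.Fin.Subset using (Subset; ∣_∣)
open import Data.Vec using (tabulate; toList)
open import Data.List using (List; filter; length)
open import Data.List using (foldr)
open import Relation.Binary.PropositionalEquality using (_≡_; _≢_)
open import Relation.Nullary using (¬_)
open import Data.Fin using (_≟_)
open import Data.Product using (_×_; Σ; ∃-syntax)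
open import Data.Vec using (lookup; allFin)

record SimpleGraph (n : ℕ) : Set where
  field
    adj   : Fin n → Fin n → Bool
    sym   : ∀ u v → adj u v ≡ adj v u
    irrefl : ∀ v → adj v v ≡ false

open SimpleGraph public

Adj : ∀ {n} → SimpleGraph n → Fin n → Fin n → Set
Adj G u v = adj G u v ≡ true

nbhd : ∀ {n} → SimpleGraph n → Fin n → Subset n
nbhd G v = tabulate (λ w → adj G v w)

degree : ∀ {n} → SimpleGraph n → Fin n → ℕ
degree G v = ∣ nbhd G v ∣

anyFin : ∀ {n} → (Fin n → Bool) → Bool
anyFin {n} p = foldr _∨_ false (toList (tabulate p))

nbhdSet : ∀ {n} → SimpleGraph n → Subset n → Subset n
nbhdSet G X = tabulate (λ w → anyFin (λ v → lookup X v ∧ adj G v w))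

HasInducedClaw : ∀ {n} → SimpleGraph n → Set
HasInducedClaw {n} G =
  Σ (Fin n) λ c → Σ (Fin n) λ a → Σ (Fin n) λ b → Σ (Fin n) λ d →
    (c ≢ a) × (c ≢ b) × (c ≢ d) × (a ≢ b) × (a ≢ d) × (b ≢ d) ×
    Adj G c a × Adj G c b × Adj G c d ×
    ¬ Adj G a b × ¬ Adj G a d × ¬ Adj G b d

{-# OPTIONS --safe #-}
-- Put I = X ∖ N(X) and Y = N(X) ∖ X. Cancelling X ∩ N(X) from |N(X)| < |X| gives |Y| < |I|.
-- A vertex of I has no neighbour in X, so I is independent and every neighbour of a vertex
-- of I lies in Y. Each vertex of I has at least two neighbours, so double counting the edges
-- between I and Y shows that some y ∈ Y has at least three neighbours in I; being pairwise
-- non-adjacent, they form an induced claw with centre y.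

module Submission where

open import Defs
open import Data.Nat using (ℕ; _<_; _≥_)
open import Data.Fin using (Fin)
open import Data.Fin.Subset using (Subset; ∣_∣)
open import Data.Product using (Σ)

open import Data.Bool using (Bool; true; false; _∧_; _∨_)
open import Data.Bool.Properties using (∨-zeroʳ)
open import Data.Fin using (zero; suc)
open import Data.Fin.Properties using (any?)
open import Data.Fin.Subset using (_∈_; _∉_; _∩_; ∁; ⁅_⁆; Nonempty; Empty)
open import Data.Fin.Subset.Properties
open import Data.Nat using (suc; _+_; _*_; _≤_; _≤?_; z≤n; s≤s; NonZero)
open import Data.Nat.Properties
open import Data.Product using (_,_; _×_; proj₁; proj₂; ∃-syntax)
open import Data.Vec using ([]; _∷_; lookup; tabulate; here; there)
open import Data.Vec.Properties using (lookup∘tabulate; []=⇒lookup; lookup⇒[]=)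
open import Function using (_∘_)
open import Relation.Binary.PropositionalEquality as ≡ using (_≡_; _≢_; refl; cong; cong₂)
open import Relation.Nullary using (¬_; yes; no; contradiction)

open import Algebra.Properties.CommutativeMonoid.Sum +-0-commutativeMonoid
  using (sum; ∑-comm; sum-cong-≗)

indicator : Bool → ℕ
indicator true  = 1
indicator false = 0

∣p∣≡∑indicator : ∀ {n} (p : Subset n) → ∣ p ∣ ≡ sum (indicator ∘ lookup p)
∣p∣≡∑indicator []          = refl
∣p∣≡∑indicator (true  ∷ p) = cong suc (∣p∣≡∑indicator p)
∣p∣≡∑indicator (false ∷ p) = ∣p∣≡∑indicator p

∣p∣*k≤∑ : ∀ {n} k (p : Subset n) (f : Fin n → ℕ) →
          (∀ {i} → i ∈ p → k ≤ f i) → ∣ p ∣ * k ≤ sum f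
∣p∣*k≤∑ k []          f k≤f = z≤n
∣p∣*k≤∑ k (true  ∷ p) f k≤f = +-mono-≤ (k≤f here) (∣p∣*k≤∑ k p (f ∘ suc) (k≤f ∘ there))
∣p∣*k≤∑ k (false ∷ p) f k≤f =
  ≤-trans (∣p∣*k≤∑ k p (f ∘ suc) (k≤f ∘ there)) (m≤n+m _ (f zero))

∑≤∣p∣*k : ∀ {n} k (p : Subset n) (f : Fin n → ℕ) →
          (∀ i → f i ≤ k) → (∀ {i} → i ∉ p → f i ≡ 0) → sum f ≤ ∣ p ∣ * k
∑≤∣p∣*k k []          f f≤k f≡0 = z≤n
∑≤∣p∣*k k (true  ∷ p) f f≤k f≡0 =
  +-mono-≤ (f≤k zero) (∑≤∣p∣*k k p (f ∘ suc) (f≤k ∘ suc) (λ i∉p → f≡0 (i∉p ∘ drop-there)))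
∑≤∣p∣*k k (false ∷ p) f f≤k f≡0 rewrite f≡0 {zero} (λ ()) =
  ∑≤∣p∣*k k p (f ∘ suc) (f≤k ∘ suc) (λ i∉p → f≡0 (i∉p ∘ drop-there))

∈tabulate⁺ : ∀ {n} {f : Fin n → Bool} {x} → f x ≡ true → x ∈ tabulate f
∈tabulate⁺ {f = f} {x} fx = lookup⇒[]= x (tabulate f) (≡.trans (lookup∘tabulate f x) fx)

∈tabulate⁻ : ∀ {n} {f : Fin n → Bool} {x} → x ∈ tabulate f → f x ≡ true
∈tabulate⁻ {f = f} {x} x∈ = ≡.trans (≡.sym (lookup∘tabulate f x)) ([]=⇒lookup x∈)

converse : ∀ {m n} → (Fin m → Subset n) → Fin n → Subset m
converse R x = tabulate (λ y → lookup (R y) x)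

∈converse⁺ : ∀ {m n} {R : Fin m → Subset n} {x y} → x ∈ R y → y ∈ converse R x
∈converse⁺ x∈Ry = ∈tabulate⁺ ([]=⇒lookup x∈Ry)

∑∣R∣≡∑∣converse-R∣ : ∀ {m n} (R : Fin m → Subset n) →
                     sum (∣_∣ ∘ R) ≡ sum (∣_∣ ∘ converse R)
∑∣R∣≡∑∣converse-R∣ R = begin
  sum (∣_∣ ∘ R)                                        ≡⟨ sum-cong-≗ (∣p∣≡∑indicator ∘ R) ⟩
  sum (λ y → sum (λ x → indicator (lookup (R y) x)))   ≡⟨ ∑-comm (λ y x → indicator (lookup (R y) x)) ⟩
  sum (λ x → sum (λ y → indicator (lookup (R y) x)))   ≡⟨ sum-cong-≗ transpose ⟩
  sum (∣_∣ ∘ converse R)                               ∎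
  where
  open ≡.≡-Reasoning
  transpose : ∀ x → sum (λ y → indicator (lookup (R y) x)) ≡ ∣ converse R x ∣
  transpose x = ≡.trans
    (sum-cong-≗ (λ y → cong indicator (≡.sym (lookup∘tabulate (λ y → lookup (R y) x) y))))
    (≡.sym (∣p∣≡∑indicator (converse R x)))

∣p∣≡∣p∩q∣+∣p∩∁q∣ : ∀ {n} (p q : Subset n) → ∣ p ∣ ≡ ∣ p ∩ q ∣ + ∣ p ∩ ∁ q ∣
∣p∣≡∣p∩q∣+∣p∩∁q∣ []          []          = refl
∣p∣≡∣p∩q∣+∣p∩∁q∣ (true  ∷ p) (true  ∷ q) = cong suc (∣p∣≡∣p∩q∣+∣p∩∁q∣ p q)
∣p∣≡∣p∩q∣+∣p∩∁q∣ (true  ∷ p) (false ∷ q) =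
  ≡.trans (cong suc (∣p∣≡∣p∩q∣+∣p∩∁q∣ p q)) (≡.sym (+-suc _ _))
∣p∣≡∣p∩q∣+∣p∩∁q∣ (false ∷ p) (_     ∷ q) = ∣p∣≡∣p∩q∣+∣p∩∁q∣ p q

∣q∣<∣p∣⇒∣q∩∁p∣<∣p∩∁q∣ : ∀ {n} (p q : Subset n) → ∣ q ∣ < ∣ p ∣ → ∣ q ∩ ∁ p ∣ < ∣ p ∩ ∁ q ∣
∣q∣<∣p∣⇒∣q∩∁p∣<∣p∩∁q∣ p q ∣q∣<∣p∣ = +-cancelˡ-< ∣ p ∩ q ∣ _ _
  (≡.subst₂ _<_ (≡.trans (∣p∣≡∣p∩q∣+∣p∩∁q∣ q p) (cong (λ r → ∣ r ∣ + ∣ q ∩ ∁ p ∣) (∩-comm q p)))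
                (∣p∣≡∣p∩q∣+∣p∩∁q∣ p q)
                ∣q∣<∣p∣)

Empty⇒∣p∣≡0 : ∀ {n} {p : Subset n} → Empty p → ∣ p ∣ ≡ 0
Empty⇒∣p∣≡0 {n} empty = ≡.trans (cong ∣_∣ (Empty-unique empty)) (∣⊥∣≡0 n)

∣p∣>0⇒Nonempty : ∀ {n} {p : Subset n} → 0 < ∣ p ∣ → Nonempty p
∣p∣>0⇒Nonempty {p = p} ∣p∣>0 with nonempty? p
... | yes nonempty = nonempty
... | no  empty    = contradiction (Empty⇒∣p∣≡0 empty) (>⇒≢ ∣p∣>0)

∣p∣≤1+∣p∩∁⁅x⁆∣ : ∀ {n} (p : Subset n) x → ∣ p ∣ ≤ suc ∣ p ∩ ∁ ⁅ x ⁆ ∣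
∣p∣≤1+∣p∩∁⁅x⁆∣ p x = begin
  ∣ p ∣                              ≡⟨ ∣p∣≡∣p∩q∣+∣p∩∁q∣ p ⁅ x ⁆ ⟩
  ∣ p ∩ ⁅ x ⁆ ∣ + ∣ p ∩ ∁ ⁅ x ⁆ ∣   ≤⟨ +-monoˡ-≤ _ (∣p∩q∣≤∣q∣ p ⁅ x ⁆) ⟩
  ∣ ⁅ x ⁆ ∣ + ∣ p ∩ ∁ ⁅ x ⁆ ∣       ≡⟨ cong (_+ ∣ p ∩ ∁ ⁅ x ⁆ ∣) (∣⁅x⁆∣≡1 x) ⟩
  suc ∣ p ∩ ∁ ⁅ x ⁆ ∣               ∎
  where open ≤-Reasoning

member-and-rest : ∀ {n k} {p : Subset n} → suc k ≤ ∣ p ∣ →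
                  ∃[ x ] x ∈ p × k ≤ ∣ p ∩ ∁ ⁅ x ⁆ ∣
member-and-rest {p = p} 1+k≤∣p∣ with ∣p∣>0⇒Nonempty (≤-trans (s≤s z≤n) 1+k≤∣p∣)
... | x , x∈p = x , x∈p , ≤-pred (≤-trans 1+k≤∣p∣ (∣p∣≤1+∣p∩∁⁅x⁆∣ p x))

∈p∩∁⁅y⁆⁻ : ∀ {n} {p : Subset n} {x y} → x ∈ p ∩ ∁ ⁅ y ⁆ → x ∈ p × x ≢ y
∈p∩∁⁅y⁆⁻ {p = p} {y = y} x∈ with x∈p∩q⁻ p (∁ ⁅ y ⁆) x∈
... | x∈p , x∈∁⁅y⁆ = x∈p , x∉⁅y⁆⇒x≢y (x∈∁p⇒x∉p x∈∁⁅y⁆)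

three-distinct-members : ∀ {n} {p : Subset n} → 3 ≤ ∣ p ∣ →
  ∃[ a ] ∃[ b ] ∃[ d ] a ∈ p × b ∈ p × d ∈ p × a ≢ b × a ≢ d × b ≢ d
three-distinct-members 3≤∣p∣ with member-and-rest 3≤∣p∣
... | a , a∈p , 2≤ with member-and-rest 2≤
... | b , b∈p-a , 1≤ with member-and-rest 1≤
... | d , d∈p-a-b , _ with ∈p∩∁⁅y⁆⁻ b∈p-a | ∈p∩∁⁅y⁆⁻ d∈p-a-b
... | b∈p , b≢a | d∈p-a , d≢b with ∈p∩∁⁅y⁆⁻ d∈p-a
... | d∈p , d≢a = a , b , d , a∈p , b∈p , d∈p , b≢a ∘ ≡.sym , d≢a ∘ ≡.sym , d≢b ∘ ≡.sym

anyFin⁺ : ∀ {n} (p : Fin n → Bool) {v} → p v ≡ true → anyFin p ≡ true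
anyFin⁺ p {zero}  pv = cong (_∨ anyFin (p ∘ suc)) pv
anyFin⁺ p {suc v} pv = ≡.trans (cong (p zero ∨_) (anyFin⁺ (p ∘ suc) pv)) (∨-zeroʳ (p zero))

module _ {n} (H : SimpleGraph n) where

  Adj-sym : ∀ {u v} → Adj H u v → Adj H v u
  Adj-sym {u} {v} uv = ≡.trans (sym H v u) uv

  Adj-irrefl : ∀ {v} → ¬ Adj H v v
  Adj-irrefl {v} vv with ≡.trans (≡.sym vv) (irrefl H v)
  ... | ()

  ∈nbhd⁺ : ∀ {v w} → Adj H v w → w ∈ nbhd H v
  ∈nbhd⁺ = ∈tabulate⁺

  ∈nbhd⁻ : ∀ {v w} → w ∈ nbhd H v → Adj H v w
  ∈nbhd⁻ = ∈tabulate⁻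

  ∈nbhdSet⁺ : ∀ {X v w} → v ∈ X → Adj H v w → w ∈ nbhdSet H X
  ∈nbhdSet⁺ {X} {v} {w} v∈X vw =
    ∈tabulate⁺ (anyFin⁺ (λ u → lookup X u ∧ adj H u w) (cong₂ _∧_ ([]=⇒lookup v∈X) vw))

  claw-from-independent-nbhd : ∀ (S : Subset n) c → (∀ {x z} → x ∈ S → z ∈ S → ¬ Adj H x z) →
                               3 ≤ ∣ S ∩ nbhd H c ∣ → HasInducedClaw H
  claw-from-independent-nbhd S c independent 3≤ with three-distinct-members 3≤
  ... | a , b , d , a∈ , b∈ , d∈ , a≢b , a≢d , b≢d =
    c , a , b , d , c≢ a∈ , c≢ b∈ , c≢ d∈ , a≢b , a≢d , b≢d ,
    c~ a∈ , c~ b∈ , c~ d∈ , ≁ a∈ b∈ , ≁ a∈ d∈ , ≁ b∈ d∈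
    where
    c~ : ∀ {x} → x ∈ S ∩ nbhd H c → Adj H c x
    c~ x∈ = ∈nbhd⁻ (proj₂ (x∈p∩q⁻ S _ x∈))
    c≢ : ∀ {x} → x ∈ S ∩ nbhd H c → c ≢ x
    c≢ x∈ refl = Adj-irrefl (c~ x∈)
    ≁ : ∀ {x z} → x ∈ S ∩ nbhd H c → z ∈ S ∩ nbhd H c → ¬ Adj H x z
    ≁ x∈ z∈ = independent (proj₁ (x∈p∩q⁻ S _ x∈)) (proj₁ (x∈p∩q⁻ S _ z∈))

module Boundary {n} (H : SimpleGraph n) (X : Subset n) where

  N[X] : Subset n
  N[X] = nbhdSet H X

  X∖N[X] : Subset n
  X∖N[X] = X ∩ ∁ N[X]

  N[X]∖X : Subset n
  N[X]∖X = N[X] ∩ ∁ X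

  X∖N[X]-independent : ∀ {x z} → x ∈ X∖N[X] → z ∈ X∖N[X] → ¬ Adj H x z
  X∖N[X]-independent x∈ z∈ xz =
    x∈∁p⇒x∉p (proj₂ (x∈p∩q⁻ X _ z∈)) (∈nbhdSet⁺ H (proj₁ (x∈p∩q⁻ X _ x∈)) xz)

  nbhd-of-X∖N[X]⊆N[X]∖X : ∀ {x y} → x ∈ X∖N[X] → Adj H x y → y ∈ N[X]∖X
  nbhd-of-X∖N[X]⊆N[X]∖X x∈ xy with x∈p∩q⁻ X _ x∈
  ... | x∈X , x∈∁N[X] = x∈p∩q⁺ (∈nbhdSet⁺ H x∈X xy ,
                               x∉p⇒x∈∁p (λ y∈X → x∈∁p⇒x∉p x∈∁N[X] (∈nbhdSet⁺ H y∈X (Adj-sym H xy))))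

  X∖N[X]-nbhd : Fin n → Subset n
  X∖N[X]-nbhd y = X∖N[X] ∩ nbhd H y

  ∣X∖N[X]∣≤∣N[X]∖X∣ : ∀ k .{{_ : NonZero k}} → (∀ v → degree H v ≥ k) →
                      (∀ y → ∣ X∖N[X]-nbhd y ∣ ≤ k) → ∣ X∖N[X] ∣ ≤ ∣ N[X]∖X ∣
  ∣X∖N[X]∣≤∣N[X]∖X∣ k deg few = *-cancelʳ-≤ _ _ k (begin
    ∣ X∖N[X] ∣ * k                    ≤⟨ ∣p∣*k≤∑ k X∖N[X] _ many ⟩
    sum (∣_∣ ∘ converse X∖N[X]-nbhd)  ≡⟨ ≡.sym (∑∣R∣≡∑∣converse-R∣ X∖N[X]-nbhd) ⟩
    sum (∣_∣ ∘ X∖N[X]-nbhd)           ≤⟨ ∑≤∣p∣*k k N[X]∖X _ few none ⟩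
    ∣ N[X]∖X ∣ * k                    ∎)
    where
    open ≤-Reasoning
    many : ∀ {x} → x ∈ X∖N[X] → k ≤ ∣ converse X∖N[X]-nbhd x ∣
    many {x} x∈ = ≤-trans (deg x) (p⊆q⇒∣p∣≤∣q∣ λ y∈ →
      ∈converse⁺ {R = X∖N[X]-nbhd} (x∈p∩q⁺ (x∈ , ∈nbhd⁺ H (Adj-sym H (∈nbhd⁻ H y∈)))))
    none : ∀ {y} → y ∉ N[X]∖X → ∣ X∖N[X]-nbhd y ∣ ≡ 0
    none y∉ = Empty⇒∣p∣≡0 λ { (x , x∈) → let x∈X∖N[X] , x∈nbhd = x∈p∩q⁻ X∖N[X] _ x∈ in
      y∉ (nbhd-of-X∖N[X]⊆N[X]∖X x∈X∖N[X] (Adj-sym H (∈nbhd⁻ H x∈nbhd))) }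

  claw-if-∣N[X]∖X∣<∣X∖N[X]∣ : (∀ v → degree H v ≥ 2) → ∣ N[X]∖X ∣ < ∣ X∖N[X] ∣ → HasInducedClaw H
  claw-if-∣N[X]∖X∣<∣X∖N[X]∣ deg ∣N[X]∖X∣<∣X∖N[X]∣ with any? (λ y → 3 ≤? ∣ X∖N[X]-nbhd y ∣)
  ... | yes (c , 3≤) = claw-from-independent-nbhd H X∖N[X] c X∖N[X]-independent 3≤
  ... | no  ¬claw    = contradiction (∣X∖N[X]∣≤∣N[X]∖X∣ 2 deg (λ y → ≤-pred (≰⇒> (¬claw ∘ (y ,_)))))
                                     (<⇒≱ ∣N[X]∖X∣<∣X∖N[X]∣)

proposition4p3 : (n : ℕ) (H : SimpleGraph n) →
    (∀ v → degree H v ≥ 2) →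
    Σ (Subset n) (λ X → ∣ nbhdSet H X ∣ < ∣ X ∣) →
    HasInducedClaw H
proposition4p3 n H deg (X , ∣N[X]∣<∣X∣) =
  Boundary.claw-if-∣N[X]∖X∣<∣X∖N[X]∣ H X deg (∣q∣<∣p∣⇒∣q∩∁p∣<∣p∩∁q∣ X (nbhdSet H X) ∣N[X]∣<∣X∣)
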